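{- For every $k\ge 4$, $\alpha(BC_k)=k$, $BC_k$ is $3$-stable, and every destabilising subset of $V(BC_k)$ of size $4$ is of one of the following three kinds: (1) a closed neighbourhood $B(u;1)$ of a vertex $u$ (a trivalent vertex together with its three neighbours); (2) an induced path $\{d_{2i-1},d_{2i},d_{2i+1},d_{2i+2}\}$; (3) an induced $4$-cycle $\{d_{2i},d_{2i+1},e_i,e_{i+1}\}$.
   Context: $BC_k$ ($k\ge4$) has vertices $d_1,\dots,d_{2k}$ and $e_1,\dots,e_k$ (indices of $d$ mod $2k$, of $e$ mod $k$), with edges $d_jd_{j+1}$ for all $j$, $e_ie_{i+1}$ for all $i$, and $d_{2i-2}e_i$, $d_{2i+1}e_i$ for $i=1,\dots,k$. $\alpha$ is the independence number. A destabiliser of a graph $H$ is a vertex subset $M$ such that the subgraph induced on $V(H)\setminus M$ has independence number less than $\alpha(H)$; $H$ is $s$-stable if it has no destabiliser of size $\le s$. -}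

module Defs where

open import Data.Nat using (ℕ; zero; suc; _+_; _*_; _∸_; _≤_; _<_; NonZero)
open import Data.Nat.DivMod using (_%_)
open import Data.Nat.Properties using (m*n≢0)
open import Data.Fin using (Fin; toℕ)
open import Data.Fin.Subset using (Subset; _∈_; _∉_; ∣_∣)
open import Data.Product using (Σ; ∃; _×_; _,_)
open import Data.Sum using (_⊎_)
open import Relation.Nullary using (¬_)
open import Relation.Binary.PropositionalEquality using (_≡_)

Graph : ℕ → Set₁
Graph n = Fin n → Fin n → Set

module _ {n : ℕ} (G : Graph n) where

  Independent : Subset n → Set
  Independent S = ∀ u v → u ∈ S → v ∈ S → ¬ G u v

  IsIndependenceNumber : ℕ → Set
  IsIndependenceNumber a =
    (Σ (Subset n) λ S → Independent S × ∣ S ∣ ≡ a)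
    × (∀ S → Independent S → ∣ S ∣ ≤ a)

  -- M is a destabiliser: the graph induced on V ∖ M has independence number
  -- smaller than α(G), i.e. every independent set of G avoiding M has size < α(G)
  Destabiliser : Subset n → Set
  Destabiliser M =
    ∀ a → IsIndependenceNumber a →
      ∀ S → Independent S → (∀ v → v ∈ S → v ∉ M) → ∣ S ∣ < a

  Stable : ℕ → Set
  Stable s = ∀ M → ∣ M ∣ ≤ s → ¬ Destabiliser M

  IsClosedNbhd : Fin n → Subset n → Set
  IsClosedNbhd u M = ∀ v → (v ∈ M → (v ≡ u ⊎ G u v)) × ((v ≡ u ⊎ G u v) → v ∈ M)

-- Numbering: d_j (indices mod 2k) is the vertex with value  j mod 2k  ∈ [0, 2k);
--            e_i (indices mod k)  is the vertex with value  2k + (i mod k) ∈ [2k, 3k).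

module _ (k : ℕ) .{{_ : NonZero k}} where

  dv : ℕ → ℕ
  dv j = _%_ j (2 * k) {{m*n≢0 2 k}}

  ev : ℕ → ℕ
  ev i = 2 * k + i % k

  BCEdge : ℕ → ℕ → Set
  BCEdge a b =
      (∃ λ j → a ≡ dv j × b ≡ dv (suc j))
    ⊎ (∃ λ i → a ≡ ev i × b ≡ ev (suc i))
    ⊎ (∃ λ i → 1 ≤ i × i ≤ k × a ≡ dv (2 * i ∸ 2) × b ≡ ev i)
    ⊎ (∃ λ i → 1 ≤ i × i ≤ k × a ≡ dv (2 * i + 1) × b ≡ ev i)

  BC : Graph (3 * k)
  BC u v = BCEdge (toℕ u) (toℕ v) ⊎ BCEdge (toℕ v) (toℕ u)

  IsDPath : ℕ → Subset (3 * k) → Set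
  IsDPath i M = ∀ v →
    (v ∈ M → (toℕ v ≡ dv (2 * i ∸ 1) ⊎ toℕ v ≡ dv (2 * i) ⊎ toℕ v ≡ dv (2 * i + 1) ⊎ toℕ v ≡ dv (2 * i + 2)))
    × ((toℕ v ≡ dv (2 * i ∸ 1) ⊎ toℕ v ≡ dv (2 * i) ⊎ toℕ v ≡ dv (2 * i + 1) ⊎ toℕ v ≡ dv (2 * i + 2)) → v ∈ M)

  IsC4 : ℕ → Subset (3 * k) → Set
  IsC4 i M = ∀ v →
    (v ∈ M → (toℕ v ≡ dv (2 * i) ⊎ toℕ v ≡ dv (2 * i + 1) ⊎ toℕ v ≡ ev i ⊎ toℕ v ≡ ev (suc i)))
    × ((toℕ v ≡ dv (2 * i) ⊎ toℕ v ≡ dv (2 * i + 1) ⊎ toℕ v ≡ ev i ⊎ toℕ v ≡ ev (suc i)) → v ∈ M)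

module Submission where

-- Cut BC_k into k blocks, block y = {d_{2y}, d_{2y+1}, e_y}.  Every
-- edge lies inside a block or between consecutive blocks, so a vertex set is a
-- k-periodic word of block states and independence is a condition on consecutive
-- states.  With vacant t = 1 for the empty state and 0 otherwise, consecutive
-- compatible states satisfy |t| + vacant t ≤ 1 + vacant s; telescoping around the
-- cycle gives α(BC_k) ≤ k, attained by the odd d's.  For a set M of at most four
-- vertices, a local repair rule picks the state of block y from the blocks
-- y-1, y, y+1 of M; a finite check shows that, unless four vertices of M form one
-- of four patterns, this is an independent k-set avoiding M.  This gives
-- 3-stability, and a destabilising 4-set must equal a pattern: an induced 4-cycle,
-- an induced d-path, or the closed neighbourhood of a d-vertex.

open import Defs
open import Data.Nat using (ℕ; zero; suc; _+_; _*_; _∸_; _≤_; _<_; z≤n; s≤s; NonZero; _/_; _%_; >-nonZero⁻¹)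
open import Data.Nat using (_≤ᵇ_; _<ᵇ_; _≡ᵇ_; _≟_; _<?_)
open import Data.Nat.Properties
open import Data.Nat.DivMod
open import Data.Nat.Tactic.RingSolver using (solve-∀)
open import Data.Bool using (Bool; true; false; _∧_; _∨_; not; T; if_then_else_)
open import Data.Bool.Properties using (T-∧; T-∨; T-≡; T?)
open import Function.Bundles using (Equivalence)
open import Data.Unit using (tt)
open import Data.Empty using (⊥; ⊥-elim)
open import Data.Product using (∃; _×_; _,_; proj₁; proj₂)
open import Data.Sum using (_⊎_; inj₁; inj₂)
open import Data.Vec using ([]; _∷_; tabulate; here; there)
open import Data.Fin using (Fin; toℕ; fromℕ<)
open import Data.Fin.Properties using (toℕ-fromℕ<; toℕ-injective; toℕ<n; any?)
open import Data.Fin.Subset using (Subset; _∈_; _∉_; ∣_∣; _-_)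
open import Data.Fin.Subset.Properties using (x∈p∧x≢y⇒x∈p-y; x∈p⇒∣p-x∣<∣p∣)
open import Relation.Nullary using (¬_; yes; no)
open import Relation.Binary.PropositionalEquality
open import Function using (_∘_; _∋_)

double-suc : ∀ n → 2 * suc n ≡ suc (suc (2 * n))
double-suc = solve-∀

odd≡suc-even : ∀ n → 2 * n + 1 ≡ suc (2 * n)
odd≡suc-even = solve-∀

suc-odd≡even : ∀ n → suc (2 * n + 1) ≡ 2 * suc n
suc-odd≡even = solve-∀

even≡even-2 : ∀ n → 2 * n ≡ 2 * suc n ∸ 2
even≡even-2 n = cong (_∸ 2) (sym (double-suc n))

even-or-odd : ∀ j → ∃ λ y → j ≡ 2 * y ⊎ j ≡ 2 * y + 1
even-or-odd zero = 0 , inj₁ refl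
even-or-odd (suc j) with even-or-odd j
... | y , inj₁ refl = y , inj₂ (sym (odd≡suc-even y))
... | y , inj₂ refl = suc y , inj₁ (suc-odd≡even y)

-- halve n = (⌊n/2⌋, whether n is odd): which d-vertex of which block n is
halve : ℕ → ℕ × Bool
halve zero = 0 , false
halve (suc zero) = 0 , true
halve (suc (suc n)) = suc (proj₁ (halve n)) , proj₂ (halve n)

halve-even : ∀ r → halve (2 * r) ≡ (r , false)
halve-even zero = refl
halve-even (suc r) rewrite double-suc r | halve-even r = refl

halve-odd : ∀ r → halve (2 * r + 1) ≡ (r , true)
halve-odd zero = refl
halve-odd (suc r) =
  trans (cong halve (odd-of-suc r)) (cong (λ p → suc (proj₁ p) , proj₂ p) (halve-odd r))
  where
    odd-of-suc : ∀ r → 2 * suc r + 1 ≡ suc (suc (2 * r + 1))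
    odd-of-suc = solve-∀

<ᵇ-true : ∀ {m n} → m < n → (m <ᵇ n) ≡ true
<ᵇ-true m<n = Equivalence.to T-≡ (<⇒<ᵇ m<n)

<ᵇ-false : ∀ {m n} → n ≤ m → (m <ᵇ n) ≡ false
<ᵇ-false {m} {n} n≤m with m <ᵇ n in eq
... | true = ⊥-elim (<⇒≱ (<ᵇ⇒< m n (subst T (sym eq) tt)) n≤m)
... | false = refl

%-cong-+ : ∀ c n .{{_ : NonZero n}} {a b} → a % n ≡ b % n → (c + a) % n ≡ (c + b) % n
%-cong-+ c n {a} {b} a≡b = begin
  (c + a) % n              ≡⟨ %-distribˡ-+ c a n ⟩
  (c % n + a % n) % n      ≡⟨ cong (λ r → (c % n + r) % n) a≡b ⟩
  (c % n + b % n) % n      ≡⟨ %-distribˡ-+ c b n ⟨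
  (c + b) % n              ∎
  where open ≡-Reasoning

suc-%-%-suc : ∀ n .{{_ : NonZero n}} y → suc y % n ≡ suc (y % n) % n
suc-%-%-suc n y = %-cong-+ 1 n (sym (m%n%n≡m%n y n))

%-cancel-suc : ∀ n .{{_ : NonZero n}} {a b} → suc a % n ≡ suc b % n → a % n ≡ b % n
%-cancel-suc n {a} {b} sa≡sb = begin
  a % n                    ≡⟨ [m+n]%n≡m%n a n ⟨
  (a + n) % n              ≡⟨ cong (_% n) (wrap a) ⟩
  (n ∸ 1 + suc a) % n      ≡⟨ %-cong-+ (n ∸ 1) n sa≡sb ⟩
  (n ∸ 1 + suc b) % n      ≡⟨ cong (_% n) (wrap b) ⟨
  (b + n) % n              ≡⟨ [m+n]%n≡m%n b n ⟩
  b % n                    ∎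
  where
    open ≡-Reasoning
    wrap : ∀ x → x + n ≡ n ∸ 1 + suc x
    wrap x = begin
      x + n                ≡⟨ +-comm x n ⟩
      n + x                ≡⟨ cong (_+ x) (m∸n+n≡m (>-nonZero⁻¹ n)) ⟨
      n ∸ 1 + 1 + x        ≡⟨ +-assoc (n ∸ 1) 1 x ⟩
      n ∸ 1 + suc x        ∎

representative : ∀ n .{{_ : NonZero n}} y → ∃ λ i → 1 ≤ i × i ≤ n × i % n ≡ y % n
representative n y with y % n in eq
... | zero = n , >-nonZero⁻¹ n , ≤-refl , n%n≡0 n
... | suc r = suc r , s≤s z≤n , <⇒≤ 1+r<n , m<n⇒m%n≡m 1+r<n
  where
    1+r<n : suc r < n
    1+r<n = subst (_< n) eq (m%n<n y n)

sumBelow : (ℕ → ℕ) → ℕ → ℕ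
sumBelow f zero = 0
sumBelow f (suc n) = sumBelow f n + f n

sum-head : ∀ f n → sumBelow f (suc n) ≡ f 0 + sumBelow (λ i → f (suc i)) n
sum-head f zero = +-comm 0 (f 0)
sum-head f (suc n) = trans (cong (_+ f (suc n)) (sum-head f n)) (+-assoc (f 0) _ _)

sum-ext : ∀ {f g} n → (∀ i → i < n → f i ≡ g i) → sumBelow f n ≡ sumBelow g n
sum-ext zero h = refl
sum-ext (suc n) h = cong₂ _+_ (sum-ext n (λ i p → h i (m≤n⇒m≤1+n p))) (h n ≤-refl)

sum-mono : ∀ {f g} n → (∀ i → i < n → f i ≤ g i) → sumBelow f n ≤ sumBelow g n
sum-mono zero h = z≤n
sum-mono (suc n) h = +-mono-≤ (sum-mono n (λ i p → h i (m≤n⇒m≤1+n p))) (h n ≤-refl)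

sum-+ : ∀ f g n → sumBelow (λ i → f i + g i) n ≡ sumBelow f n + sumBelow g n
sum-+ f g zero = refl
sum-+ f g (suc n) rewrite sum-+ f g n = interchange (sumBelow f n) (sumBelow g n) (f n) (g n)
  where
    interchange : ∀ a b c d → a + b + (c + d) ≡ a + c + (b + d)
    interchange = solve-∀

sum-ones : ∀ n → sumBelow (λ _ → 1) n ≡ n
sum-ones zero = refl
sum-ones (suc n) rewrite sum-ones n = +-comm n 1

sum-split : ∀ f m n → sumBelow f (m + n) ≡ sumBelow f m + sumBelow (λ i → f (m + i)) n
sum-split f m zero rewrite +-identityʳ m = sym (+-identityʳ _)
sum-split f m (suc n) rewrite +-suc m n | sum-split f m n = +-assoc (sumBelow f m) _ _

sum-pairs : ∀ f n → sumBelow f (2 * n) ≡ sumBelow (λ i → f (2 * i) + f (2 * i + 1)) n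
sum-pairs f zero = refl
sum-pairs f (suc n) = begin
  sumBelow f (2 * suc n)                        ≡⟨ cong (sumBelow f) (double-suc n) ⟩
  sumBelow f (2 * n) + f (2 * n) + f (suc (2 * n))
    ≡⟨ cong (λ s → s + f (2 * n) + f (suc (2 * n))) (sum-pairs f n) ⟩
  sumBelow g n + f (2 * n) + f (suc (2 * n))    ≡⟨ +-assoc (sumBelow g n) _ _ ⟩
  sumBelow g n + (f (2 * n) + f (suc (2 * n)))
    ≡⟨ cong (λ j → sumBelow g n + (f (2 * n) + f j)) (sym (odd≡suc-even n)) ⟩
  sumBelow g n + g n                            ∎
  where
    open ≡-Reasoning
    g : ℕ → ℕ
    g i = f (2 * i) + f (2 * i + 1)

sum-shift : ∀ f n → f n ≡ f 0 → sumBelow (λ i → f (suc i)) n ≡ sumBelow f n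
sum-shift f zero _ = refl
sum-shift f (suc m) wrap = begin
  sumBelow (λ i → f (suc i)) m + f (suc m)  ≡⟨ cong (sumBelow (λ i → f (suc i)) m +_) wrap ⟩
  sumBelow (λ i → f (suc i)) m + f 0        ≡⟨ +-comm _ (f 0) ⟩
  f 0 + sumBelow (λ i → f (suc i)) m        ≡⟨ sym (sum-head f m) ⟩
  sumBelow f (suc m)                        ∎
  where open ≡-Reasoning

sum-rotate : ∀ f n b → (∀ i → f (i + n) ≡ f i) → sumBelow (λ i → f (b + i)) n ≡ sumBelow f n
sum-rotate f n zero periodic = refl
sum-rotate f n (suc b) periodic =
  trans (sum-ext n (λ i _ → cong f (sym (+-suc b i))))
  (trans (sum-shift (λ i → f (b + i)) n (trans (periodic b) (cong f (sym (+-identityʳ b)))))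
         (sum-rotate f n b periodic))

sum-prefix : ∀ f m n → m ≤ n → sumBelow f m ≤ sumBelow f n
sum-prefix f m n m≤n with m≤n⇒∃[o]m+o≡n m≤n
... | o , refl = subst (sumBelow f m ≤_) (sym (sum-split f m o)) (m≤m+n _ _)

module Telescope (f φ : ℕ → ℕ) (n : ℕ) (cyclic : f n + φ n ≡ f 0 + φ 0) where
  private
    shifted : sumBelow (λ y → f (suc y) + φ (suc y)) n ≡ sumBelow f n + sumBelow φ n
    shifted = trans (sum-shift (λ y → f y + φ y) n cyclic) (sum-+ f φ n)
    budget : sumBelow (λ y → 1 + φ y) n ≡ n + sumBelow φ n
    budget = trans (sum-+ (λ _ → 1) φ n) (cong (_+ sumBelow φ n) (sum-ones n))

  telescope-≤ : (∀ y → y < n → f (suc y) + φ (suc y) ≤ 1 + φ y) → sumBelow f n ≤ n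
  telescope-≤ step = +-cancelʳ-≤ (sumBelow φ n) _ _ (subst₂ _≤_ shifted budget (sum-mono n step))

  telescope-≡ : (∀ y → y < n → f (suc y) + φ (suc y) ≡ 1 + φ y) → sumBelow f n ≡ n
  telescope-≡ step = +-cancelʳ-≡ (sumBelow φ n) _ _ (trans (sym shifted) (trans (sum-ext n step) budget))

-- Statements about finitely many booleans are decided by evaluation: a boolean
-- formula that evaluates to true yields the corresponding proposition.

_⇒ᵇ_ : Bool → Bool → Bool
a ⇒ᵇ b = not a ∨ b

modus-ponens : ∀ {a b} → T (a ⇒ᵇ b) → T a → T b
modus-ponens {true} ab _ = ab

modus-ponens-≤ : ∀ {a m n} → T (a ⇒ᵇ (m ≤ᵇ n)) → T a → m ≤ n
modus-ponens-≤ {m = m} {n} h a = ≤ᵇ⇒≤ m n (modus-ponens h a)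

excludes : ∀ {a b} → T (not (a ∧ b)) → T a → T b → ⊥
excludes {true} {true} ()

not-both : ∀ {a b} → (T a → T b → ⊥) → T (not (a ∧ b))
not-both {true} {true} h = h tt tt
not-both {true} {false} h = tt
not-both {false} h = tt

¬T⇒T-not : ∀ {a} → ¬ T a → T (not a)
¬T⇒T-not {false} _ = tt
¬T⇒T-not {true} ¬a = ¬a tt

split : ∀ {a b} → T (a ∧ b) → T a × T b
split = Equivalence.to T-∧

join : ∀ {a b} → T a → T b → T (a ∧ b)
join p q = Equivalence.from T-∧ (p , q)

split⁴ : ∀ {a b c d} → T (a ∧ b ∧ c ∧ d) → T a × T b × T c × T d
split⁴ {true} {true} {true} {true} _ = tt , tt , tt , tt

join⁴ : ∀ {a b c d} → T a → T b → T c → T d → T (a ∧ b ∧ c ∧ d)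
join⁴ {true} {true} {true} {true} _ _ _ _ = tt

∀𝔹 : (Bool → Bool) → Bool
∀𝔹 P = P false ∧ P true

∀𝔹-sound : ∀ P → T (∀𝔹 P) → ∀ b → T (P b)
∀𝔹-sound P h false = proj₁ (split h)
∀𝔹-sound P h true = proj₂ (split h)

-- Block states.  A block of a vertex set X records which of
-- d_{2y}, d_{2y+1}, e_y belong to X.

record Block : Set where
  constructor ⟨_,_,_⟩
  field
    dEven dOdd eV : Bool
open Block

∀Block : (Block → Bool) → Bool
∀Block P = ∀𝔹 λ a → ∀𝔹 λ b → ∀𝔹 λ c → P ⟨ a , b , c ⟩

∀Block-sound : ∀ P → T (∀Block P) → ∀ t → T (P t)
∀Block-sound P h ⟨ a , b , c ⟩ =
  ∀𝔹-sound (λ c → P ⟨ a , b , c ⟩)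
    (∀𝔹-sound (λ b → ∀𝔹 λ c → P ⟨ a , b , c ⟩)
      (∀𝔹-sound (λ a → ∀𝔹 λ b → ∀𝔹 λ c → P ⟨ a , b , c ⟩) h a) b) c

∀Block²-sound : ∀ (P : Block → Block → Bool) →
  T (∀Block λ s → ∀Block λ t → P s t) → ∀ s t → T (P s t)
∀Block²-sound P h s = ∀Block-sound (P s) (∀Block-sound (λ s → ∀Block (P s)) h s)

∀Block³-sound : ∀ (P : Block → Block → Block → Bool) →
  T (∀Block λ s → ∀Block λ t → ∀Block λ u → P s t u) → ∀ s t u → T (P s t u)
∀Block³-sound P h s =
  ∀Block²-sound (P s) (∀Block-sound (λ s → ∀Block λ t → ∀Block (P s t)) h s)

∀Block⁴-sound : ∀ (P : Block → Block → Block → Block → Bool) →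
  T (∀Block λ s → ∀Block λ t → ∀Block λ u → ∀Block λ v → P s t u v) → ∀ s t u v → T (P s t u v)
∀Block⁴-sound P h s =
  ∀Block³-sound (P s) (∀Block-sound (λ s → ∀Block λ t → ∀Block λ u → ∀Block (P s t u)) h s)

bit : Bool → ℕ
bit true = 1
bit false = 0

size : Block → ℕ
size t = bit (dEven t) + bit (dOdd t) + bit (eV t)

vacant : Block → ℕ
vacant t = if dEven t ∨ dOdd t ∨ eV t then 0 else 1

-- independence inside a block (edges d_{2y}d_{2y+1}, d_{2y+1}e_y) and between
-- consecutive blocks (edges d_{2y+1}d_{2y+2}, e_y e_{y+1}, d_{2y}e_{y+1})
internal : Block → Bool
internal t = not (dEven t ∧ dOdd t) ∧ not (dOdd t ∧ eV t)

compatible : Block → Block → Bool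
compatible s t = internal s ∧ internal t
  ∧ not (dOdd s ∧ dEven t) ∧ not (eV s ∧ eV t) ∧ not (dEven s ∧ eV t)

record Compatible (s t : Block) : Set where
  field
    inside-s   : T (internal s)
    inside-t   : T (internal t)
    dOdd-dEven : T (not (dOdd s ∧ dEven t))
    eV-eV      : T (not (eV s ∧ eV t))
    dEven-eV   : T (not (dEven s ∧ eV t))

compatible-parts : ∀ {s t} → T (compatible s t) → Compatible s t
compatible-parts c with split c
... | i , c₁ with split c₁
... | j , c₂ with split c₂
... | p , c₃ with split c₃
... | q , r = record { inside-s = i ; inside-t = j ; dOdd-dEven = p ; eV-eV = q ; dEven-eV = r }

compatible-intro : ∀ {s t} → Compatible s t → T (compatible s t)
compatible-intro c = join inside-s (join inside-t (join dOdd-dEven (join eV-eV dEven-eV)))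
  where open Compatible c

disjoint : Block → Block → Bool
disjoint f s = not (dEven f ∧ dEven s) ∧ not (dOdd f ∧ dOdd s) ∧ not (eV f ∧ eV s)

disjoint-parts : ∀ {f s} → T (disjoint f s) →
  T (not (dEven f ∧ dEven s)) × T (not (dOdd f ∧ dOdd s)) × T (not (eV f ∧ eV s))
disjoint-parts d with split d
... | p , d′ = p , split d′

potential-step : ∀ s t → T (compatible s t) → size t + vacant t ≤ 1 + vacant s
potential-step s t = modus-ponens-≤ (∀Block²-sound
  (λ s t → compatible s t ⇒ᵇ (size t + vacant t ≤ᵇ 1 + vacant s)) tt s t)

-- The four 4-vertex patterns, placed at consecutive blocks x, y, z of a set,
-- x being block j:
--   fourCycle : the induced 4-cycle {d_{2j}, d_{2j+1}, e_j, e_{j+1}}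
--   oddBall   : the closed neighbourhood {d_{2j}, d_{2j+1}, e_j, d_{2j+2}} of d_{2j+1}
--   dPath     : the induced path {d_{2j+1}, d_{2j+2}, d_{2j+3}, d_{2j+4}}
--   evenBall  : the closed neighbourhood {d_{2j+1}, d_{2j+2}, d_{2j+3}, e_{j+2}} of d_{2j+2}
data Shape : Set where
  fourCycle oddBall dPath evenBall : Shape

shapeOn : Shape → Block → Block → Block → Bool
shapeOn fourCycle x y z = dEven x ∧ dOdd x ∧ eV x ∧ eV y
shapeOn oddBall x y z = dEven x ∧ dOdd x ∧ eV x ∧ dEven y
shapeOn dPath x y z = dOdd x ∧ dEven y ∧ dOdd y ∧ dEven z
shapeOn evenBall x y z = dOdd x ∧ dEven y ∧ dOdd y ∧ eV z

patternAt : Block → Block → Block → Bool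
patternAt x y z =
  shapeOn fourCycle x y z ∨ shapeOn oddBall x y z ∨ shapeOn dPath x y z ∨ shapeOn evenBall x y z

some-shape : ∀ x y z → T (patternAt x y z) → ∃ λ s → T (shapeOn s x y z)
some-shape x y z p with Equivalence.to T-∨ p
... | inj₁ h = fourCycle , h
... | inj₂ p₁ with Equivalence.to T-∨ p₁
... | inj₁ h = oddBall , h
... | inj₂ p₂ with Equivalence.to T-∨ p₂
... | inj₁ h = dPath , h
... | inj₂ h = evenBall , h

shape-size : ∀ s x y z → T (shapeOn s x y z) → 4 ≤ size x + size y + size z
shape-size s x y z = modus-ponens-≤
  (∀Block³-sound (λ x y z → shapeOn s x y z ⇒ᵇ (4 ≤ᵇ size x + size y + size z)) (decided s) x y z)
  where
    decided : ∀ s → T (∀Block λ x → ∀Block λ y → ∀Block λ z →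
                        shapeOn s x y z ⇒ᵇ (4 ≤ᵇ size x + size y + size z))
    decided fourCycle = tt
    decided oddBall = tt
    decided dPath = tt
    decided evenBall = tt

-- The repair rule (found by computer search): the state of block y of the new
-- independent set, given the blocks y-1, y, y+1 of the set M to be avoided
-- (first matching clause; _ marks an irrelevant bit).  Away from M block y
-- contributes d_{2y}; near M the rule shifts to d_{2y+1}, e_y, or {d_{2y}, e_y}
-- after an empty block.
repair : Block → Block → Block → Block
repair ⟨ false , _ , false ⟩ ⟨ false , false , false ⟩ ⟨ false , _ , _ ⟩ = ⟨ true , false , false ⟩
repair ⟨ false , false , false ⟩ ⟨ false , false , true ⟩ ⟨ false , false , _ ⟩ = ⟨ false , true , false ⟩
repair ⟨ false , false , false ⟩ ⟨ false , false , true ⟩ ⟨ false , true , false ⟩ = ⟨ false , true , false ⟩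
repair ⟨ false , false , false ⟩ ⟨ false , false , true ⟩ ⟨ false , true , true ⟩ = ⟨ true , false , false ⟩
repair ⟨ false , true , false ⟩ ⟨ false , false , true ⟩ ⟨ false , _ , _ ⟩ = ⟨ false , true , false ⟩
repair ⟨ false , false , false ⟩ ⟨ true , false , false ⟩ ⟨ false , false , _ ⟩ = ⟨ false , true , false ⟩
repair ⟨ false , false , false ⟩ ⟨ true , false , false ⟩ ⟨ false , true , false ⟩ = ⟨ false , true , false ⟩
repair ⟨ false , false , false ⟩ ⟨ true , false , false ⟩ ⟨ false , true , true ⟩ = ⟨ false , false , true ⟩
repair ⟨ false , false , false ⟩ ⟨ true , false , true ⟩ ⟨ false , _ , _ ⟩ = ⟨ false , true , false ⟩
repair ⟨ false , true , false ⟩ ⟨ true , false , _ ⟩ ⟨ false , _ , _ ⟩ = ⟨ false , true , false ⟩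
repair ⟨ false , _ , false ⟩ ⟨ _ , false , _ ⟩ ⟨ true , _ , _ ⟩ = ⟨ false , true , false ⟩
repair ⟨ false , false , true ⟩ ⟨ false , false , false ⟩ ⟨ false , _ , _ ⟩ = ⟨ false , false , true ⟩
repair ⟨ false , false , true ⟩ ⟨ false , false , false ⟩ ⟨ true , _ , _ ⟩ = ⟨ false , true , false ⟩
repair ⟨ false , true , true ⟩ ⟨ false , false , false ⟩ ⟨ _ , _ , _ ⟩ = ⟨ true , false , true ⟩
repair ⟨ false , _ , true ⟩ ⟨ false , false , true ⟩ ⟨ _ , _ , _ ⟩ = ⟨ false , true , false ⟩
repair ⟨ false , _ , true ⟩ ⟨ true , false , _ ⟩ ⟨ _ , _ , _ ⟩ = ⟨ false , true , false ⟩
repair ⟨ true , false , false ⟩ ⟨ false , false , false ⟩ ⟨ false , _ , _ ⟩ = ⟨ false , false , true ⟩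
repair ⟨ true , false , true ⟩ ⟨ false , false , false ⟩ ⟨ false , _ , false ⟩ = ⟨ false , false , true ⟩
repair ⟨ true , false , true ⟩ ⟨ false , false , false ⟩ ⟨ false , _ , true ⟩ = ⟨ false , true , false ⟩
repair ⟨ true , false , _ ⟩ ⟨ false , false , false ⟩ ⟨ true , _ , _ ⟩ = ⟨ false , true , false ⟩
repair ⟨ true , true , _ ⟩ ⟨ false , false , false ⟩ ⟨ _ , _ , _ ⟩ = ⟨ true , false , true ⟩
repair ⟨ true , _ , _ ⟩ ⟨ false , false , true ⟩ ⟨ _ , _ , _ ⟩ = ⟨ false , true , false ⟩
repair ⟨ true , _ , _ ⟩ ⟨ true , false , _ ⟩ ⟨ _ , _ , _ ⟩ = ⟨ false , true , false ⟩
repair ⟨ false , false , false ⟩ ⟨ false , true , false ⟩ ⟨ _ , _ , _ ⟩ = ⟨ true , false , false ⟩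
repair ⟨ false , false , true ⟩ ⟨ false , true , false ⟩ ⟨ _ , _ , _ ⟩ = ⟨ false , false , true ⟩
repair ⟨ false , true , _ ⟩ ⟨ false , true , false ⟩ ⟨ _ , _ , _ ⟩ = ⟨ true , false , false ⟩
repair ⟨ true , false , _ ⟩ ⟨ false , true , false ⟩ ⟨ _ , _ , _ ⟩ = ⟨ false , false , true ⟩
repair ⟨ true , true , _ ⟩ ⟨ false , true , false ⟩ ⟨ _ , _ , _ ⟩ = ⟨ true , false , true ⟩
repair ⟨ _ , _ , _ ⟩ ⟨ false , true , true ⟩ ⟨ false , false , false ⟩ = ⟨ false , false , false ⟩
repair ⟨ _ , _ , _ ⟩ ⟨ false , true , true ⟩ ⟨ false , false , true ⟩ = ⟨ true , false , false ⟩
repair ⟨ _ , _ , _ ⟩ ⟨ false , true , true ⟩ ⟨ false , true , _ ⟩ = ⟨ true , false , false ⟩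
repair ⟨ _ , _ , _ ⟩ ⟨ false , true , true ⟩ ⟨ true , _ , _ ⟩ = ⟨ true , false , false ⟩
repair ⟨ _ , _ , _ ⟩ ⟨ true , true , false ⟩ ⟨ false , _ , false ⟩ = ⟨ false , false , false ⟩
repair ⟨ _ , _ , _ ⟩ ⟨ true , true , false ⟩ ⟨ false , _ , true ⟩ = ⟨ false , false , true ⟩
repair ⟨ _ , _ , _ ⟩ ⟨ true , true , false ⟩ ⟨ true , _ , _ ⟩ = ⟨ false , false , true ⟩
repair ⟨ _ , _ , _ ⟩ ⟨ true , true , true ⟩ ⟨ _ , _ , _ ⟩ = ⟨ false , false , false ⟩

harmless : Block → Block → Block → Block → Bool
harmless w₀ w₁ w₂ w₃ =
  (total ≤ᵇ 3) ∨ ((total ≤ᵇ 4) ∧ not (patternAt w₀ w₁ w₂) ∧ not (patternAt w₁ w₂ w₃))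
  where
    total : ℕ
    total = size w₀ + size w₁ + size w₂ + size w₃

repairs : Block → Block → Block → Block → Bool
repairs w₀ w₁ w₂ w₃ = compatible s t ∧ (size t + vacant t ≡ᵇ 1 + vacant s) ∧ disjoint w₁ s
  where
    s t : Block
    s = repair w₀ w₁ w₂
    t = repair w₁ w₂ w₃

repair-sound : ∀ w₀ w₁ w₂ w₃ → T (harmless w₀ w₁ w₂ w₃) →
    T (compatible (repair w₀ w₁ w₂) (repair w₁ w₂ w₃))
  × size (repair w₁ w₂ w₃) + vacant (repair w₁ w₂ w₃) ≡ 1 + vacant (repair w₀ w₁ w₂)
  × T (disjoint w₁ (repair w₀ w₁ w₂))
repair-sound w₀ w₁ w₂ w₃ h with split (modus-ponens (∀Block⁴-sound
  (λ w₀ w₁ w₂ w₃ → harmless w₀ w₁ w₂ w₃ ⇒ᵇ repairs w₀ w₁ w₂ w₃) tt w₀ w₁ w₂ w₃) h)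
... | compat , rest with split rest
... | tight , avoids = compat , ≡ᵇ⇒≡ _ _ tight , avoids

member : ∀ {m} → Subset m → ℕ → Bool
member [] _ = false
member (x ∷ X) zero = x
member (x ∷ X) (suc n) = member X n

∈⇒member : ∀ {m} {X : Subset m} {v : Fin m} → v ∈ X → T (member X (toℕ v))
∈⇒member here = tt
∈⇒member (there v∈X) = ∈⇒member v∈X

∈⇒memberₙ : ∀ {m} {X : Subset m} {v : Fin m} {n} → toℕ v ≡ n → v ∈ X → T (member X n)
∈⇒memberₙ {X = X} refl v∈X = ∈⇒member v∈X

member⇒∈ : ∀ {m} (X : Subset m) (v : Fin m) → T (member X (toℕ v)) → v ∈ X
member⇒∈ (true ∷ X) Fin.zero _ = here
member⇒∈ (x ∷ X) (Fin.suc v) h = there (member⇒∈ X v h)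

member⇒∈ₙ : ∀ {m n} (X : Subset m) (n<m : n < m) → T (member X n) → fromℕ< n<m ∈ X
member⇒∈ₙ X n<m h = member⇒∈ X (fromℕ< n<m) (subst (T ∘ member X) (sym (toℕ-fromℕ< n<m)) h)

member-tabulate : ∀ m (g : ℕ → Bool) n → n < m → member (tabulate {n = m} (g ∘ toℕ)) n ≡ g n
member-tabulate (suc m) g zero _ = refl
member-tabulate (suc m) g (suc n) (s≤s n<m) = member-tabulate m (g ∘ suc) n n<m

∣∣≡sum : ∀ {m} (X : Subset m) → ∣ X ∣ ≡ sumBelow (bit ∘ member X) m
∣∣≡sum [] = refl
∣∣≡sum {suc m} (true ∷ X) = trans (cong suc (∣∣≡sum X)) (sym (sum-head (bit ∘ member (true ∷ X)) m))
∣∣≡sum {suc m} (false ∷ X) = trans (∣∣≡sum X) (sym (sum-head (bit ∘ member (false ∷ X)) m))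

member⇒< : ∀ {m} (X : Subset m) n → T (member X n) → n < m
member⇒< (x ∷ X) zero _ = s≤s z≤n
member⇒< (x ∷ X) (suc n) h = s≤s (member⇒< X n h)

member-remove : ∀ {m} (X : Subset m) (v : Fin m) {n} → T (member X n) → toℕ v ≢ n →
  T (member (X - v) n)
member-remove {m} X v {n} h v≢n = ∈⇒memberₙ (toℕ-fromℕ< n<m)
  (x∈p∧x≢y⇒x∈p-y (member⇒∈ₙ X n<m h)
    (λ w≡v → v≢n (trans (cong toℕ (sym w≡v)) (toℕ-fromℕ< n<m))))
  where
    n<m : n < m
    n<m = member⇒< X n h

Quad : Set
Quad = ℕ × ℕ × ℕ × ℕ

quad-cong : ∀ {a b c d a′ b′ c′ d′} → a ≡ a′ → b ≡ b′ → c ≡ c′ → d ≡ d′ →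
  (Quad ∋ (a , b , c , d)) ≡ (a′ , b′ , c′ , d′)
quad-cong refl refl refl refl = refl

OneOf : Quad → ℕ → Set
OneOf (a , b , c , d) n = n ≡ a ⊎ n ≡ b ⊎ n ≡ c ⊎ n ≡ d

containsAll : ∀ {m} → Subset m → Quad → Bool
containsAll X (a , b , c , d) = member X a ∧ member X b ∧ member X c ∧ member X d

Exactly : ∀ {m} → Subset m → Quad → Set
Exactly M q = ∀ v → (v ∈ M → OneOf q (toℕ v)) × (OneOf q (toℕ v) → v ∈ M)

four-element-set : ∀ {m} (M : Subset m) → ∣ M ∣ ≡ 4 → ∀ q → T (containsAll M q) →
  (∀ N → T (containsAll N q) → 4 ≤ ∣ N ∣) → Exactly M q
four-element-set M ∣M∣≡4 q@(a , b , c , d) has needs-four v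
  with split⁴ {member M a} {member M b} {member M c} {member M d} has
... | ha , hb , hc , hd = inside , outside
  where

    outside : OneOf q (toℕ v) → v ∈ M
    outside (inj₁ refl) = member⇒∈ M v ha
    outside (inj₂ (inj₁ refl)) = member⇒∈ M v hb
    outside (inj₂ (inj₂ (inj₁ refl))) = member⇒∈ M v hc
    outside (inj₂ (inj₂ (inj₂ refl))) = member⇒∈ M v hd

    inside : v ∈ M → OneOf q (toℕ v)
    inside v∈M with toℕ v ≟ a | toℕ v ≟ b | toℕ v ≟ c | toℕ v ≟ d
    ... | yes eq | _ | _ | _ = inj₁ eq
    ... | no _ | yes eq | _ | _ = inj₂ (inj₁ eq)
    ... | no _ | no _ | yes eq | _ = inj₂ (inj₂ (inj₁ eq))
    ... | no _ | no _ | no _ | yes eq = inj₂ (inj₂ (inj₂ eq))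
    ... | no v≢a | no v≢b | no v≢c | no v≢d = ⊥-elim (<⇒≱ fewer (needs-four (M - v) still-contains))
      where
        fewer : ∣ M - v ∣ < 4
        fewer = subst (∣ M - v ∣ <_) ∣M∣≡4 (x∈p⇒∣p-x∣<∣p∣ v∈M)
        still-contains : T (containsAll (M - v) q)
        still-contains = join⁴ (member-remove M v ha v≢a) (member-remove M v hb v≢b)
                               (member-remove M v hc v≢c) (member-remove M v hd v≢d)

module Numbering (k : ℕ) {{_ : NonZero k}} where

  instance
    nonZero-2k : NonZero (2 * k)
    nonZero-2k = m*n≢0 2 k

  D E : ℕ → ℕ
  D = dv k
  E = ev k

  3k≡2k+k : 3 * k ≡ 2 * k + k
  3k≡2k+k = identity k
    where
      identity : ∀ k → 3 * k ≡ 2 * k + k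
      identity = solve-∀

  D<2k : ∀ j → D j < 2 * k
  D<2k j = m%n<n j (2 * k)

  D<3k : ∀ j → D j < 3 * k
  D<3k j = subst (D j <_) (sym 3k≡2k+k) (<-≤-trans (D<2k j) (m≤m+n (2 * k) k))

  E<3k : ∀ i → E i < 3 * k
  E<3k i = subst (E i <_) (sym 3k≡2k+k) (+-monoʳ-< (2 * k) (m%n<n i k))

  E≢D : ∀ i j → E i ≢ D j
  E≢D i j eq = <⇒≱ (D<2k j) (subst (2 * k ≤_) eq (m≤m+n (2 * k) (i % k)))

  even<2k : ∀ {r} → r < k → 2 * r < 2 * k
  even<2k = *-monoʳ-< 2

  odd<2k : ∀ {r} → r < k → 2 * r + 1 < 2 * k
  odd<2k {r} r<k = subst (_≤ 2 * k) (sym (suc-odd≡even r)) (*-monoʳ-≤ 2 r<k)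

  D-reduce : ∀ y c → D (2 * y + c) ≡ D (2 * (y % k) + c)
  D-reduce y c = begin
    D (2 * y + c)                          ≡⟨ cong (λ x → D (2 * x + c)) (m≡m%n+[m/n]*n y k) ⟩
    D (2 * (y % k + y / k * k) + c)        ≡⟨ cong D (regroup (y % k) (y / k) c k) ⟩
    D (2 * (y % k) + c + y / k * (2 * k))  ≡⟨ [m+kn]%n≡m%n (2 * (y % k) + c) (y / k) (2 * k) ⟩
    D (2 * (y % k) + c)                    ∎
    where
      open ≡-Reasoning
      regroup : ∀ r q c k → 2 * (r + q * k) + c ≡ 2 * r + c + q * (2 * k)
      regroup = solve-∀

  D-even : ∀ y → D (2 * y) ≡ 2 * (y % k)
  D-even y = begin
    D (2 * y)                ≡⟨ cong D (+-identityʳ (2 * y)) ⟨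
    D (2 * y + 0)            ≡⟨ D-reduce y 0 ⟩
    D (2 * (y % k) + 0)      ≡⟨ cong D (+-identityʳ (2 * (y % k))) ⟩
    D (2 * (y % k))          ≡⟨ m<n⇒m%n≡m (even<2k (m%n<n y k)) ⟩
    2 * (y % k)              ∎
    where open ≡-Reasoning

  D-odd : ∀ y → D (2 * y + 1) ≡ 2 * (y % k) + 1
  D-odd y = trans (D-reduce y 1) (m<n⇒m%n≡m (odd<2k (m%n<n y k)))

  D-even-mod : ∀ {a b} → a % k ≡ b % k → D (2 * a) ≡ D (2 * b)
  D-even-mod {a} {b} eq = trans (D-even a) (trans (cong (2 *_) eq) (sym (D-even b)))

  D-odd-mod : ∀ {a b} → a % k ≡ b % k → D (2 * a + 1) ≡ D (2 * b + 1)
  D-odd-mod {a} {b} eq = trans (D-odd a) (trans (cong (λ r → 2 * r + 1) eq) (sym (D-odd b)))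

  D-even-cancel : ∀ {a b} → D (2 * a) ≡ D (2 * b) → a % k ≡ b % k
  D-even-cancel {a} {b} eq = *-cancelˡ-≡ (a % k) (b % k) 2 (trans (sym (D-even a)) (trans eq (D-even b)))

  D-odd-cancel : ∀ {a b} → D (2 * a + 1) ≡ D (2 * b + 1) → a % k ≡ b % k
  D-odd-cancel {a} {b} eq =
    *-cancelˡ-≡ (a % k) (b % k) 2 (+-cancelʳ-≡ 1 _ _ (trans (sym (D-odd a)) (trans eq (D-odd b))))

  D-even≢D-odd : ∀ a b → D (2 * a) ≢ D (2 * b + 1)
  D-even≢D-odd a b eq =
    even≢odd (a % k) (b % k) (trans (sym (D-even a)) (trans eq (trans (D-odd b) (odd≡suc-even (b % k)))))

  D-cong-suc : ∀ {j j'} → D j ≡ D j' → D (suc j) ≡ D (suc j')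
  D-cong-suc = %-cong-+ 1 (2 * k)

  D-cancel-suc : ∀ {j j'} → D (suc j) ≡ D (suc j') → D j ≡ D j'
  D-cancel-suc = %-cancel-suc (2 * k)

  E-mod : ∀ {a b} → a % k ≡ b % k → E a ≡ E b
  E-mod = cong (2 * k +_)

  E-mod-suc : ∀ {a b} → a % k ≡ b % k → E (suc a) ≡ E (suc b)
  E-mod-suc eq = E-mod (%-cong-+ 1 k eq)

  decode : ∀ n → n < 3 * k → ∃ λ y → n ≡ D (2 * y) ⊎ n ≡ D (2 * y + 1) ⊎ n ≡ E y
  decode n n<3k with n <? 2 * k
  ... | yes n<2k with even-or-odd n
  ...   | y , inj₁ refl = y , inj₁ (sym (m<n⇒m%n≡m n<2k))
  ...   | y , inj₂ refl = y , inj₂ (inj₁ (sym (m<n⇒m%n≡m n<2k)))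
  decode n n<3k | no n≮2k with m≤n⇒∃[o]m+o≡n (≮⇒≥ n≮2k)
  ... | y , refl = y , inj₂ (inj₂ (cong (2 * k +_) (sym (m<n⇒m%n≡m y<k))))
    where
      y<k : y < k
      y<k = +-cancelˡ-< (2 * k) y k (subst (2 * k + y <_) 3k≡2k+k n<3k)

module Blocks (k : ℕ) {{_ : NonZero k}} where
  open Numbering k

  Vertices : Set
  Vertices = Subset (3 * k)

  block : Vertices → ℕ → Block
  block X y = ⟨ member X (D (2 * y)) , member X (D (2 * y + 1)) , member X (E y) ⟩

  block-mod : ∀ X {a b} → a % k ≡ b % k → block X a ≡ block X b
  block-mod X eq =
    cong₂ (λ p c → ⟨ proj₁ p , proj₂ p , c ⟩)
      (cong₂ _,_ (cong (member X) (D-even-mod eq)) (cong (member X) (D-odd-mod eq)))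
      (cong (member X) (E-mod eq))

  block-wrap : ∀ X y → block X (y + k) ≡ block X y
  block-wrap X y = block-mod X ([m+n]%n≡m%n y k)

  ∣∣≡block-sizes : ∀ X → ∣ X ∣ ≡ sumBelow (size ∘ block X) k
  ∣∣≡block-sizes X = begin
    ∣ X ∣                                                     ≡⟨ ∣∣≡sum X ⟩
    sumBelow f (3 * k)                                        ≡⟨ cong (sumBelow f) 3k≡2k+k ⟩
    sumBelow f (2 * k + k)                                    ≡⟨ sum-split f (2 * k) k ⟩
    sumBelow f (2 * k) + sumBelow (λ y → f (2 * k + y)) k
      ≡⟨ cong (_+ sumBelow (λ y → f (2 * k + y)) k) (sum-pairs f k) ⟩
    sumBelow (λ y → f (2 * y) + f (2 * y + 1)) k + sumBelow (λ y → f (2 * k + y)) k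
      ≡⟨ sum-+ (λ y → f (2 * y) + f (2 * y + 1)) (λ y → f (2 * k + y)) k ⟨
    sumBelow (λ y → f (2 * y) + f (2 * y + 1) + f (2 * k + y)) k
      ≡⟨ sum-ext k block-size ⟩
    sumBelow (size ∘ block X) k                               ∎
    where
      open ≡-Reasoning
      f : ℕ → ℕ
      f = bit ∘ member X
      block-size : ∀ y → y < k → f (2 * y) + f (2 * y + 1) + f (2 * k + y) ≡ size (block X y)
      block-size y y<k =
        cong₂ _+_ (cong₂ _+_ (cong f (sym (m<n⇒m%n≡m (even<2k y<k))))
                             (cong f (sym (m<n⇒m%n≡m (odd<2k y<k)))))
                  (cong (λ r → f (2 * k + r)) (sym (m<n⇒m%n≡m y<k)))

  window : 4 ≤ k → ∀ X y →
    size (block X y) + size (block X (1 + y)) + size (block X (2 + y)) + size (block X (3 + y)) ≤ ∣ X ∣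
  window 4≤k X y = begin
    g y + g (1 + y) + g (2 + y) + g (3 + y)   ≡⟨ four-terms ⟨
    sumBelow (λ i → g (y + i)) 4              ≤⟨ sum-prefix (λ i → g (y + i)) 4 k 4≤k ⟩
    sumBelow (λ i → g (y + i)) k              ≡⟨ sum-rotate g k y (block-wrap-size) ⟩
    sumBelow g k                              ≡⟨ ∣∣≡block-sizes X ⟨
    ∣ X ∣                                     ∎
    where
      open ≤-Reasoning
      g : ℕ → ℕ
      g = size ∘ block X
      block-wrap-size : ∀ i → g (i + k) ≡ g i
      block-wrap-size i = cong size (block-wrap X i)
      four-terms : sumBelow (λ i → g (y + i)) 4 ≡ g y + g (1 + y) + g (2 + y) + g (3 + y)
      four-terms = cong₂ _+_ (cong₂ _+_ (cong₂ _+_ (cong g (+-identityʳ y)) (cong g (+-comm y 1)))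
                                         (cong g (+-comm y 2)))
                             (cong g (+-comm y 3))

  realisedAt : (ℕ → Block) → ℕ → Bool
  realisedAt W n =
    if n <ᵇ 2 * k then dBit (W (proj₁ (halve n))) (proj₂ (halve n)) else eV (W (n ∸ 2 * k))
    where
      dBit : Block → Bool → Bool
      dBit t false = dEven t
      dBit t true = dOdd t

  realise : (ℕ → Block) → Vertices
  realise W = tabulate (realisedAt W ∘ toℕ)

  block-realise : ∀ W y → block (realise W) y ≡ W (y % k)
  block-realise W y = cong₂ (λ p c → ⟨ proj₁ p , proj₂ p , c ⟩)
      (cong₂ _,_ (reads (D<3k _) (trans (cong (realisedAt W) (D-even y)) (at-even (m%n<n y k))))
                 (reads (D<3k _) (trans (cong (realisedAt W) (D-odd y)) (at-odd (m%n<n y k)))))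
      (reads (E<3k _) at-spoke)
    where
      reads : ∀ {n b} → n < 3 * k → realisedAt W n ≡ b → member (realise W) n ≡ b
      reads n<3k eq = trans (member-tabulate (3 * k) (realisedAt W) _ n<3k) eq
      at-even : ∀ {r} → r < k → realisedAt W (2 * r) ≡ dEven (W r)
      at-even {r} r<k rewrite <ᵇ-true (even<2k r<k) | halve-even r = refl
      at-odd : ∀ {r} → r < k → realisedAt W (2 * r + 1) ≡ dOdd (W r)
      at-odd {r} r<k rewrite <ᵇ-true (odd<2k r<k) | halve-odd r = refl
      at-spoke : realisedAt W (E y) ≡ eV (W (y % k))
      at-spoke rewrite <ᵇ-false (m≤m+n (2 * k) (y % k)) | m+n∸m≡n (2 * k) (y % k) = refl

  disjoint-blocks : ∀ X Y → (∀ y → T (disjoint (block X y) (block Y y))) → ∀ v → v ∈ Y → v ∉ X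
  disjoint-blocks X Y dis v v∈Y v∈X with decode (toℕ v) (toℕ<n v)
  ... | y , position with disjoint-parts {block X y} {block Y y} (dis y)
  ... | no-dEven , no-dOdd , no-eV with position
  ... | inj₁ eq = excludes no-dEven (∈⇒memberₙ eq v∈X) (∈⇒memberₙ eq v∈Y)
  ... | inj₂ (inj₁ eq) = excludes no-dOdd (∈⇒memberₙ eq v∈X) (∈⇒memberₙ eq v∈Y)
  ... | inj₂ (inj₂ eq) = excludes no-eV (∈⇒memberₙ eq v∈X) (∈⇒memberₙ eq v∈Y)

module Independence (k : ℕ) {{_ : NonZero k}} where
  open Numbering k
  open Blocks k

  path-edge : ∀ j → BCEdge k (D j) (D (suc j))
  path-edge j = inj₁ (j , refl , refl)

  rim-edge : ∀ y → BCEdge k (E y) (E (suc y))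
  rim-edge y = inj₂ (inj₁ (y , refl , refl))

  spoke-even : ∀ y → BCEdge k (D (2 * y)) (E (suc y))
  spoke-even y with representative k (suc y)
  ... | suc i , 1≤i , i≤k , i≡y =
    inj₂ (inj₂ (inj₁ (suc i , 1≤i , i≤k ,
      trans (D-even-mod (%-cancel-suc k (sym i≡y))) (cong D (even≡even-2 i)) , E-mod (sym i≡y))))

  spoke-odd : ∀ y → BCEdge k (D (2 * y + 1)) (E y)
  spoke-odd y with representative k y
  ... | i , 1≤i , i≤k , i≡y = inj₂ (inj₂ (inj₂ (i , 1≤i , i≤k , D-odd-mod (sym i≡y) , E-mod (sym i≡y))))

  no-edge-inside : ∀ X → Independent (BC k) X → ∀ {n₁ n₂} → n₁ < 3 * k → n₂ < 3 * k →
    BCEdge k n₁ n₂ → T (member X n₁) → T (member X n₂) → ⊥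
  no-edge-inside X ind n₁<3k n₂<3k edge h₁ h₂ =
    ind (fromℕ< n₁<3k) (fromℕ< n₂<3k) (member⇒∈ₙ X n₁<3k h₁) (member⇒∈ₙ X n₂<3k h₂)
      (inj₁ (subst₂ (BCEdge k) (sym (toℕ-fromℕ< n₁<3k)) (sym (toℕ-fromℕ< n₂<3k)) edge))

  independent⇒compatible : ∀ X → Independent (BC k) X → ∀ y → T (compatible (block X y) (block X (suc y)))
  independent⇒compatible X ind y = compatible-intro {block X y} {block X (suc y)} (record
    { inside-s = inside y
    ; inside-t = inside (suc y)
    ; dOdd-dEven = not-both (conflict (D<3k _) (D<3k _)
                     (subst (BCEdge k _) (cong D (suc-odd≡even y)) (path-edge (2 * y + 1))))
    ; eV-eV = not-both (conflict (E<3k _) (E<3k _) (rim-edge y))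
    ; dEven-eV = not-both (conflict (D<3k _) (E<3k _) (spoke-even y))
    })
    where
      conflict : ∀ {n₁ n₂} → n₁ < 3 * k → n₂ < 3 * k →
        BCEdge k n₁ n₂ → T (member X n₁) → T (member X n₂) → ⊥
      conflict = no-edge-inside X ind
      inside : ∀ y → T (internal (block X y))
      inside y = join
        (not-both (conflict (D<3k _) (D<3k _) (subst (BCEdge k _) (cong D (sym (odd≡suc-even y))) (path-edge (2 * y)))))
        (not-both (conflict (D<3k _) (E<3k _) (spoke-odd y)))

  compatible⇒independent : ∀ X → (∀ y → T (compatible (block X y) (block X (suc y)))) → Independent (BC k) X
  compatible⇒independent X compat u v u∈X v∈X (inj₁ edge) = excluded edge (∈⇒member u∈X) (∈⇒member v∈X)
    where
      parts : ∀ y → Compatible (block X y) (block X (suc y))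
      parts y = compatible-parts (compat y)
      at : ∀ {n m} → n ≡ m → T (member X n) → T (member X m)
      at eq = subst (T ∘ member X) eq
      excluded : ∀ {n₁ n₂} → BCEdge k n₁ n₂ → T (member X n₁) → T (member X n₂) → ⊥
      excluded (inj₁ (j , refl , refl)) h₁ h₂ with even-or-odd j
      ... | y , inj₁ refl =
        excludes (proj₁ (split (Compatible.inside-s (parts y)))) h₁ (at (cong D (sym (odd≡suc-even y))) h₂)
      ... | y , inj₂ refl = excludes (Compatible.dOdd-dEven (parts y)) h₁ (at (cong D (suc-odd≡even y)) h₂)
      excluded (inj₂ (inj₁ (i , refl , refl))) h₁ h₂ = excludes (Compatible.eV-eV (parts i)) h₁ h₂
      excluded (inj₂ (inj₂ (inj₁ (zero , () , _))))
      excluded (inj₂ (inj₂ (inj₁ (suc i , _ , _ , refl , refl)))) h₁ h₂ =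
        excludes (Compatible.dEven-eV (parts i)) (at (cong D (sym (even≡even-2 i))) h₁) h₂
      excluded (inj₂ (inj₂ (inj₂ (i , _ , _ , refl , refl)))) h₁ h₂ =
        excludes (proj₂ (split (Compatible.inside-s (parts i)))) h₁ h₂
  compatible⇒independent X compat u v u∈X v∈X (inj₂ edge) =
    compatible⇒independent X compat v u v∈X u∈X (inj₁ edge)

module IndependenceNumber (k : ℕ) {{_ : NonZero k}} where
  open Numbering k
  open Blocks k
  open Independence k

  -- the potential telescopes around the cycle of blocks
  independent-≤k : ∀ X → Independent (BC k) X → ∣ X ∣ ≤ k
  independent-≤k X ind = subst (_≤ k) (sym (∣∣≡block-sizes X))
    (Telescope.telescope-≤ (size ∘ block X) (vacant ∘ block X) k
      (cong (λ t → size t + vacant t) (block-wrap X 0))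
      (λ y _ → potential-step (block X y) (block X (suc y)) (independent⇒compatible X ind y)))

  module Realised (W : ℕ → Block) (cyclic : W k ≡ W 0) where

    W-next : ∀ y → W (suc y % k) ≡ W (suc (y % k))
    W-next y with m≤n⇒m<n∨m≡n (m%n<n y k)
    ... | inj₁ 1+r<k = cong W (trans (suc-%-%-suc k y) (m<n⇒m%n≡m 1+r<k))
    ... | inj₂ 1+r≡k = trans (cong W (trans (suc-%-%-suc k y) (trans (cong (_% k) 1+r≡k) (n%n≡0 k))))
                             (trans (sym cyclic) (cong W (sym 1+r≡k)))

    realise-independent : (∀ y → T (compatible (W y) (W (suc y)))) → Independent (BC k) (realise W)
    realise-independent compat = compatible⇒independent (realise W) λ y →
      subst₂ (λ s t → T (compatible s t)) (sym (block-realise W y))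
        (sym (trans (block-realise W (suc y)) (W-next y))) (compat (y % k))

    realise-size : (∀ y → size (W (suc y)) + vacant (W (suc y)) ≡ 1 + vacant (W y)) → ∣ realise W ∣ ≡ k
    realise-size tight = begin
      ∣ realise W ∣                       ≡⟨ ∣∣≡block-sizes (realise W) ⟩
      sumBelow (size ∘ block (realise W)) k
        ≡⟨ sum-ext k (λ y y<k → cong size (trans (block-realise W y) (cong W (m<n⇒m%n≡m y<k)))) ⟩
      sumBelow (size ∘ W) k               ≡⟨ Telescope.telescope-≡ (size ∘ W) (vacant ∘ W) k
                                               (cong (λ t → size t + vacant t) cyclic) (λ y _ → tight y) ⟩
      k                                   ∎
      where open ≡-Reasoning

    realise-avoids : ∀ M → (∀ y → T (disjoint (block M y) (W y))) → ∀ v → v ∈ realise W → v ∉ M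
    realise-avoids M dis = disjoint-blocks M (realise W) λ y →
      subst₂ (λ s t → T (disjoint s t)) (block-mod M (m%n%n≡m%n y k)) (sym (block-realise W y)) (dis (y % k))

  α≡k : IsIndependenceNumber (BC k) k
  α≡k = (realise oddDs , realise-independent (λ _ → tt) , realise-size (λ _ → refl)) , independent-≤k
    where
      oddDs : ℕ → Block
      oddDs _ = ⟨ false , true , false ⟩
      open Realised oddDs refl

module Stability (k : ℕ) {{_ : NonZero k}} (4≤k : 4 ≤ k) where
  open Numbering k
  open Blocks k
  open IndependenceNumber k

  harmlessAt : Vertices → ℕ → Bool
  harmlessAt M j = harmless (block M j) (block M (1 + j)) (block M (2 + j)) (block M (3 + j))

  patternIn : Vertices → ℕ → Bool
  patternIn M j = patternAt (block M j) (block M (1 + j)) (block M (2 + j))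

  patternIn-mod : ∀ M {a b} → a % k ≡ b % k → patternIn M a ≡ patternIn M b
  patternIn-mod M eq = cong₂ (λ x yz → patternAt x (proj₁ yz) (proj₂ yz)) (block-mod M eq)
    (cong₂ _,_ (block-mod M (%-cong-+ 1 k eq)) (block-mod M (%-cong-+ 2 k eq)))

  -- If every window of M is harmless, the repaired word is an independent set
  -- of size k avoiding M, so M is not a destabiliser.
  harmless⇒not-destabiliser : ∀ M → (∀ j → T (harmlessAt M j)) → ¬ Destabiliser (BC k) M
  harmless⇒not-destabiliser M harmless-everywhere dest =
    <-irrefl size≡k (dest k α≡k (realise W) independent avoids)
    where
      -- block y - 1, taken modulo k
      previous : ℕ → ℕ
      previous y = y + (k ∸ 1)

      repairAt : ℕ → Block
      repairAt j = repair (block M j) (block M (1 + j)) (block M (2 + j))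

      W : ℕ → Block
      W y = repairAt (previous y)

      cyclic : W k ≡ W 0
      cyclic = cong₂ (λ x yz → repair x (proj₁ yz) (proj₂ yz)) (block-mod M k+j≡j)
        (cong₂ _,_ (block-mod M (%-cong-+ 1 k k+j≡j)) (block-mod M (%-cong-+ 2 k k+j≡j)))
        where
          k+j≡j : (k + (k ∸ 1)) % k ≡ (k ∸ 1) % k
          k+j≡j = trans (cong (_% k) (+-comm k (k ∸ 1))) ([m+n]%n≡m%n (k ∸ 1) k)
      open Realised W cyclic

      repaired : ∀ y →
          T (compatible (W y) (W (suc y)))
        × size (W (suc y)) + vacant (W (suc y)) ≡ 1 + vacant (W y)
        × T (disjoint (block M (1 + previous y)) (W y))
      repaired y = repair-sound (block M j) (block M (1 + j)) (block M (2 + j)) (block M (3 + j))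
                     (harmless-everywhere j)
        where
          j : ℕ
          j = previous y

      independent : Independent (BC k) (realise W)
      independent = realise-independent (proj₁ ∘ repaired)

      size≡k : ∣ realise W ∣ ≡ k
      size≡k = realise-size (proj₁ ∘ proj₂ ∘ repaired)

      centre : ∀ y → block M (1 + previous y) ≡ block M y
      centre y = trans (cong (block M) (trans (sym (+-suc y (k ∸ 1))) (cong (y +_) (m+[n∸m]≡n (>-nonZero⁻¹ k)))))
                       (block-wrap M y)

      avoids : ∀ v → v ∈ realise W → v ∉ M
      avoids = realise-avoids M λ y →
        subst (λ b → T (disjoint b (W y))) (centre y) (proj₂ (proj₂ (repaired y)))

  -- BC_k is 3-stable: every window of a set of at most three vertices is harmless
  three-stable : Stable (BC k) 3
  three-stable M ∣M∣≤3 = harmless⇒not-destabiliser M λ j →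
    Equivalence.from T-∨ (inj₁ (≤⇒≤ᵇ (≤-trans (window 4≤k M j) ∣M∣≤3)))

  pattern-free⇒not-destabiliser : ∀ M → ∣ M ∣ ≡ 4 → (∀ j → T (not (patternIn M j))) →
    ¬ Destabiliser (BC k) M
  pattern-free⇒not-destabiliser M ∣M∣≡4 free = harmless⇒not-destabiliser M λ j →
    Equivalence.from T-∨ (inj₂ (join (≤⇒≤ᵇ (≤-trans (window 4≤k M j) (≤-reflexive ∣M∣≡4)))
                                     (join (free j) (free (1 + j)))))

module Classification (k : ℕ) {{_ : NonZero k}} (4≤k : 4 ≤ k) where
  open Numbering k
  open Blocks k
  open Independence k
  open Stability k 4≤k

  corners : Shape → ℕ → Quad
  corners fourCycle j = D (2 * j) , D (2 * j + 1) , E j , E (1 + j)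
  corners oddBall j = D (2 * j) , D (2 * j + 1) , E j , D (2 * (1 + j))
  corners dPath j = D (2 * j + 1) , D (2 * (1 + j)) , D (2 * (1 + j) + 1) , D (2 * (2 + j))
  corners evenBall j = D (2 * j + 1) , D (2 * (1 + j)) , D (2 * (1 + j) + 1) , E (2 + j)

  shapeIn : Shape → Vertices → ℕ → Bool
  shapeIn s X j = shapeOn s (block X j) (block X (1 + j)) (block X (2 + j))

  shapeIn≡containsAll : ∀ s X j → shapeIn s X j ≡ containsAll X (corners s j)
  shapeIn≡containsAll fourCycle X j = refl
  shapeIn≡containsAll oddBall X j = refl
  shapeIn≡containsAll dPath X j = refl
  shapeIn≡containsAll evenBall X j = refl

  corners-mod : ∀ s {a b} → a % k ≡ b % k → corners s a ≡ corners s b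
  corners-mod fourCycle eq = quad-cong (D-even-mod eq) (D-odd-mod eq) (E-mod eq) (E-mod-suc eq)
  corners-mod oddBall eq = quad-cong (D-even-mod eq) (D-odd-mod eq) (E-mod eq) (D-even-mod (%-cong-+ 1 k eq))
  corners-mod dPath eq = quad-cong (D-odd-mod eq) (D-even-mod (%-cong-+ 1 k eq))
                                   (D-odd-mod (%-cong-+ 1 k eq)) (D-even-mod (%-cong-+ 2 k eq))
  corners-mod evenBall eq = quad-cong (D-odd-mod eq) (D-even-mod (%-cong-+ 1 k eq))
                                      (D-odd-mod (%-cong-+ 1 k eq)) (E-mod (%-cong-+ 2 k eq))

  corners-need-four : ∀ s j N → T (containsAll N (corners s j)) → 4 ≤ ∣ N ∣
  corners-need-four s j N h = begin
    4                               ≤⟨ shape-size s (block N j) (block N (1 + j)) (block N (2 + j))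
                                         (subst T (sym (shapeIn≡containsAll s N j)) h) ⟩
    b j + b (1 + j) + b (2 + j)     ≤⟨ m≤m+n _ (b (3 + j)) ⟩
    b j + b (1 + j) + b (2 + j) + b (3 + j)  ≤⟨ window 4≤k N j ⟩
    ∣ N ∣                           ∎
    where
      open ≤-Reasoning
      b : ℕ → ℕ
      b = size ∘ block N

  -- A destabilising 4-set contains a pattern somewhere in one period (otherwise
  -- it would be pattern-free, everywhere by periodicity), hence is its corners.
  destabiliser-is-shape : ∀ M → ∣ M ∣ ≡ 4 → Destabiliser (BC k) M →
    ∃ λ j → j < k × ∃ λ s → Exactly M (corners s j)
  destabiliser-is-shape M ∣M∣≡4 dest with any? (λ (i : Fin k) → T? (patternIn M (toℕ i)))
  ... | yes (i , p) with some-shape (block M (toℕ i)) (block M (1 + toℕ i)) (block M (2 + toℕ i)) p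
  ...   | s , h = toℕ i , toℕ<n i , s ,
    four-element-set M ∣M∣≡4 (corners s (toℕ i)) (subst T (shapeIn≡containsAll s M (toℕ i)) h)
      (corners-need-four s (toℕ i))
  destabiliser-is-shape M ∣M∣≡4 dest | no none =
    ⊥-elim (pattern-free⇒not-destabiliser M ∣M∣≡4 free dest)
    where
      free : ∀ j → T (not (patternIn M j))
      free j = subst (T ∘ not) (patternIn-mod M (m%n%n≡m%n j k)) (¬T⇒T-not λ p →
        none (fromℕ< (m%n<n j k) , subst (T ∘ patternIn M) (sym (toℕ-fromℕ< (m%n<n j k))) p))

  neighbours-of-odd : ∀ j {p q} → p ≡ D (2 * j + 1) → BCEdge k p q ⊎ BCEdge k q p →
    q ≡ D (2 * j) ⊎ q ≡ D (2 * suc j) ⊎ q ≡ E j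
  neighbours-of-odd j eq (inj₁ (inj₁ (_ , refl , refl))) =
    inj₂ (inj₁ (trans (D-cong-suc eq) (cong D (suc-odd≡even j))))
  neighbours-of-odd j eq (inj₁ (inj₂ (inj₁ (i , refl , _)))) = ⊥-elim (E≢D _ _ eq)
  neighbours-of-odd j eq (inj₁ (inj₂ (inj₂ (inj₁ (zero , () , _)))))
  neighbours-of-odd j eq (inj₁ (inj₂ (inj₂ (inj₁ (suc i , _ , _ , refl , refl))))) =
    ⊥-elim (D-even≢D-odd i j (trans (cong D (even≡even-2 i)) eq))
  neighbours-of-odd j eq (inj₁ (inj₂ (inj₂ (inj₂ (i , _ , _ , refl , refl))))) =
    inj₂ (inj₂ (E-mod (D-odd-cancel eq)))
  neighbours-of-odd j eq (inj₂ (inj₁ (_ , refl , refl))) =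
    inj₁ (D-cancel-suc (trans eq (cong D (odd≡suc-even j))))
  neighbours-of-odd j eq (inj₂ (inj₂ (inj₁ (_ , refl , refl)))) = ⊥-elim (E≢D _ _ eq)
  neighbours-of-odd j eq (inj₂ (inj₂ (inj₂ (inj₁ (_ , _ , _ , _ , refl))))) = ⊥-elim (E≢D _ _ eq)
  neighbours-of-odd j eq (inj₂ (inj₂ (inj₂ (inj₂ (_ , _ , _ , _ , refl))))) = ⊥-elim (E≢D _ _ eq)

  neighbours-of-even : ∀ j {p q} → p ≡ D (2 * suc j) → BCEdge k p q ⊎ BCEdge k q p →
    q ≡ D (2 * j + 1) ⊎ q ≡ D (2 * suc j + 1) ⊎ q ≡ E (suc (suc j))
  neighbours-of-even j eq (inj₁ (inj₁ (_ , refl , refl))) =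
    inj₂ (inj₁ (trans (D-cong-suc eq) (cong D (sym (odd≡suc-even (suc j))))))
  neighbours-of-even j eq (inj₁ (inj₂ (inj₁ (i , refl , _)))) = ⊥-elim (E≢D _ _ eq)
  neighbours-of-even j eq (inj₁ (inj₂ (inj₂ (inj₁ (zero , () , _)))))
  neighbours-of-even j eq (inj₁ (inj₂ (inj₂ (inj₁ (suc i , _ , _ , refl , refl))))) =
    inj₂ (inj₂ (E-mod-suc (D-even-cancel (trans (cong D (even≡even-2 i)) eq))))
  neighbours-of-even j eq (inj₁ (inj₂ (inj₂ (inj₂ (i , _ , _ , refl , refl))))) =
    ⊥-elim (D-even≢D-odd (suc j) i (sym eq))
  neighbours-of-even j eq (inj₂ (inj₁ (_ , refl , refl))) =
    inj₁ (D-cancel-suc (trans eq (cong D (sym (suc-odd≡even j)))))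
  neighbours-of-even j eq (inj₂ (inj₂ (inj₁ (_ , refl , refl)))) = ⊥-elim (E≢D _ _ eq)
  neighbours-of-even j eq (inj₂ (inj₂ (inj₂ (inj₁ (_ , _ , _ , _ , refl))))) = ⊥-elim (E≢D _ _ eq)
  neighbours-of-even j eq (inj₂ (inj₂ (inj₂ (inj₂ (_ , _ , _ , _ , refl))))) = ⊥-elim (E≢D _ _ eq)

  ClosedNbhdIs : Fin (3 * k) → Quad → Set
  ClosedNbhdIs u q = ∀ v →
    ((v ≡ u ⊎ BC k u v) → OneOf q (toℕ v)) × (OneOf q (toℕ v) → (v ≡ u ⊎ BC k u v))

  exactly-ball : ∀ M u q → ClosedNbhdIs u q → Exactly M q → IsClosedNbhd (BC k) u M
  exactly-ball M u q ball exact v =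
    (λ v∈M → proj₂ (ball v) (proj₁ (exact v) v∈M)) , (λ near → proj₂ (exact v) (proj₁ (ball v) near))

  odd-ball : ∀ j → ClosedNbhdIs (fromℕ< (D<3k (2 * j + 1))) (corners oddBall j)
  odd-ball j v = into , back
    where
      u : Fin (3 * k)
      u = fromℕ< (D<3k (2 * j + 1))
      u≡ : toℕ u ≡ D (2 * j + 1)
      u≡ = toℕ-fromℕ< (D<3k (2 * j + 1))
      into : (v ≡ u ⊎ BC k u v) → OneOf (corners oddBall j) (toℕ v)
      into (inj₁ refl) = inj₂ (inj₁ u≡)
      into (inj₂ adjacent) with neighbours-of-odd j u≡ adjacent
      ... | inj₁ eq = inj₁ eq
      ... | inj₂ (inj₁ eq) = inj₂ (inj₂ (inj₂ eq))
      ... | inj₂ (inj₂ eq) = inj₂ (inj₂ (inj₁ eq))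
      back : OneOf (corners oddBall j) (toℕ v) → (v ≡ u ⊎ BC k u v)
      back (inj₁ eq) = inj₂ (inj₂ (subst₂ (BCEdge k) (sym eq)
        (trans (cong D (sym (odd≡suc-even j))) (sym u≡)) (path-edge (2 * j))))
      back (inj₂ (inj₁ eq)) = inj₁ (toℕ-injective (trans eq (sym u≡)))
      back (inj₂ (inj₂ (inj₁ eq))) = inj₂ (inj₁ (subst₂ (BCEdge k) (sym u≡) (sym eq) (spoke-odd j)))
      back (inj₂ (inj₂ (inj₂ eq))) = inj₂ (inj₁ (subst₂ (BCEdge k) (sym u≡)
        (trans (cong D (suc-odd≡even j)) (sym eq)) (path-edge (2 * j + 1))))

  even-ball : ∀ j → ClosedNbhdIs (fromℕ< (D<3k (2 * suc j))) (corners evenBall j)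
  even-ball j v = into , back
    where
      u : Fin (3 * k)
      u = fromℕ< (D<3k (2 * suc j))
      u≡ : toℕ u ≡ D (2 * suc j)
      u≡ = toℕ-fromℕ< (D<3k (2 * suc j))
      into : (v ≡ u ⊎ BC k u v) → OneOf (corners evenBall j) (toℕ v)
      into (inj₁ refl) = inj₂ (inj₁ u≡)
      into (inj₂ adjacent) with neighbours-of-even j u≡ adjacent
      ... | inj₁ eq = inj₁ eq
      ... | inj₂ (inj₁ eq) = inj₂ (inj₂ (inj₁ eq))
      ... | inj₂ (inj₂ eq) = inj₂ (inj₂ (inj₂ eq))
      back : OneOf (corners evenBall j) (toℕ v) → (v ≡ u ⊎ BC k u v)
      back (inj₁ eq) = inj₂ (inj₂ (subst₂ (BCEdge k) (sym eq)
        (trans (cong D (suc-odd≡even j)) (sym u≡)) (path-edge (2 * j + 1))))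
      back (inj₂ (inj₁ eq)) = inj₁ (toℕ-injective (trans eq (sym u≡)))
      back (inj₂ (inj₂ (inj₁ eq))) = inj₂ (inj₁ (subst₂ (BCEdge k) (sym u≡)
        (trans (cong D (sym (odd≡suc-even (suc j)))) (sym eq)) (path-edge (2 * suc j))))
      back (inj₂ (inj₂ (inj₂ eq))) = inj₂ (inj₁ (subst₂ (BCEdge k) (sym u≡) (sym eq) (spoke-even (suc j))))

  Kind : Vertices → Set
  Kind M = (∃ λ (u : Fin (3 * k)) → IsClosedNbhd (BC k) u M)
         ⊎ (∃ λ i → 1 ≤ i × i ≤ k × IsDPath k i M)
         ⊎ (∃ λ i → 1 ≤ i × i ≤ k × IsC4 k i M)

  shape-kind : ∀ M s j → j < k → Exactly M (corners s j) → Kind M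
  shape-kind M fourCycle j _ exact with representative k j
  ... | i , 1≤i , i≤k , i≡j =
    inj₂ (inj₂ (i , 1≤i , i≤k , subst (Exactly M) (corners-mod fourCycle (sym i≡j)) exact))
  shape-kind M dPath j j<k exact =
    inj₂ (inj₁ (suc j , s≤s z≤n , j<k , subst (Exactly M) path-corners exact))
    where
      last : ∀ j → 2 * (2 + j) ≡ 2 * suc j + 2
      last = solve-∀
      path-corners :
        corners dPath j ≡ (D (2 * suc j ∸ 1) , D (2 * suc j) , D (2 * suc j + 1) , D (2 * suc j + 2))
      path-corners = quad-cong (cong (D ∘ (_∸ 1)) (suc-odd≡even j)) refl refl (cong D (last j))
  shape-kind M oddBall j _ exact = inj₁ (_ , exactly-ball M _ _ (odd-ball j) exact)
  shape-kind M evenBall j _ exact = inj₁ (_ , exactly-ball M _ _ (even-ball j) exact)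

  classification : ∀ M → ∣ M ∣ ≡ 4 → Destabiliser (BC k) M → Kind M
  classification M ∣M∣≡4 dest with destabiliser-is-shape M ∣M∣≡4 dest
  ... | j , j<k , s , exact = shape-kind M s j j<k exact

-- Lemma 5.2.  The modules need the instance NonZero k to be relevant, so k is
-- matched as a successor (4 ≤ k rules out k = 0).

lemma5p2 : (k : ℕ) .{{_ : NonZero k}} → 4 ≤ k →
    IsIndependenceNumber (BC k) k
    × Stable (BC k) 3
    × (∀ (M : Subset (3 * k)) → ∣ M ∣ ≡ 4 → Destabiliser (BC k) M →
         (∃ λ (u : Fin (3 * k)) → IsClosedNbhd (BC k) u M)
         ⊎ (∃ λ i → 1 ≤ i × i ≤ k × IsDPath k i M)
         ⊎ (∃ λ i → 1 ≤ i × i ≤ k × IsC4 k i M))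
lemma5p2 (suc k) 4≤k = α≡k , three-stable , classification
  where
    open IndependenceNumber (suc k)
    open Stability (suc k) 4≤k
    open Classification (suc k) 4≤k
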